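{- For any integers $k\ge 1$, $C\ge 0$ and any $\varepsilon>0$ there exists $n_0(k,C,\varepsilon)$ such that for $n\ge n_0(k,C,\varepsilon)$ Constructor can play on $K_n$ in the $S_{k+1}$-free $C$-BSFN game so that after some round $t\ge 1$ the following hold, where $G_t[\mathcal{C}]$ and $G_t[\mathcal{B}]$ denote the graphs of the first $t$ edges claimed by Constructor and by Blocker, respectively: (1) $d_{G_t[\mathcal{C}]}(v)\in\{k-1,k\}$ for all $v\in V(K_n)$; (2) if $d_{G_t[\mathcal{C}]}(v)=k-1$, then $d_{G_t[\mathcal{C}]\cup G_t[\mathcal{B}]}(v)\le \varepsilon n$; (3) $|\{v\in V(K_n): d_{G_t[\mathcal{C}]}(v)=k\}|\le \varepsilon n$.
   Context: $S_{k+1}$ is the star with $k+1$ leaves. The $S_{k+1}$-free $C$-BSFN game on $n$ vertices: Constructor and Blocker alternately claim previously unclaimed edges of $K_n$, Constructor first. Blocker may claim any unclaimed edge. Constructor's graph must never contain a copy of $S_{k+1}$; in addition, before each Constructor move a family $\{F_v : v\in V(K_n)\}$ of vertex sets is given (arbitrarily, possibly changing from move to move) with $|F_v|\le C$ for all $v$ and $u\in F_v$ iff $v\in F_u$, and Constructor may not claim an edge $uv$ with $u\in F_v$.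
   Formalization: The parameter ε ranges over the positive rationals. -}

module Defs where

open import Data.Nat using (ℕ; zero; suc; _≤_; _<_; _∸_)
open import Data.Fin using (Fin; _≟_)
open import Data.Fin.Subset using (Subset; _∈_; ∣_∣)
open import Data.List using (List; []; _∷_; map; filter; length; _++_; allFin)
open import Data.Product using (Σ; _×_; _,_; proj₁; proj₂)
open import Data.Sum using (_⊎_)
open import Data.Integer using (+_)
open import Data.Rational using (ℚ; _/_; _*_) renaming (_≤_ to _≤ℚ_)
open import Relation.Nullary using (¬_)
open import Relation.Binary.PropositionalEquality using (_≡_; _≢_)
import Data.Nat as N

⟦_⟧ : ℕ → ℚ
⟦ m ⟧ = (+ m) / 1

-- An edge of K_n is given by its two endpoints (an unordered pair;
-- see _≈ₑ_).  It must be proper (distinct endpoints) to be legal.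
Edge : ℕ → Set
Edge n = Fin n × Fin n

Proper : ∀ {n} → Edge n → Set
Proper (u , v) = u ≢ v

_≈ₑ_ : ∀ {n} → Edge n → Edge n → Set
(u , v) ≈ₑ (x , y) = (u ≡ x × v ≡ y) ⊎ (u ≡ y × v ≡ x)

Unclaimed : ∀ {n} → Edge n → List (Edge n) → Set
Unclaimed e [] = Data.Unit.⊤ where import Data.Unit
Unclaimed e (f ∷ es) = (¬ (e ≈ₑ f)) × Unclaimed e es

Incident : ∀ {n} → Fin n → Edge n → Set
Incident v (a , b) = (v ≡ a) ⊎ (v ≡ b)

deg : ∀ {n} → Fin n → List (Edge n) → ℕ
deg v es = length (filter (λ e → incident? e) es)
  where
  import Relation.Nullary.Decidable as D
  incident? : ∀ e → Relation.Nullary.Dec (Incident v e)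
  incident? (a , b) = (v ≟ a) D.⊎-dec (v ≟ b)

Family : ℕ → Set
Family n = Fin n → Subset n

ValidFamily : ∀ {n} → ℕ → Family n → Set
ValidFamily {n} C F =
  ((v : Fin n) → ∣ F v ∣ ≤ C) ×
  ((u v : Fin n) → (u ∈ F v → v ∈ F u) × (v ∈ F u → u ∈ F v))

Forbidden : ∀ {n} → Family n → Edge n → Set
Forbidden F (u , v) = u ∈ F v

-- S_{k+1}-free : no vertex has k+1 (or more) incident edges
StarFree : ∀ {n} → ℕ → List (Edge n) → Set
StarFree {n} k es = (v : Fin n) → deg v es ≤ k

-- A round: the family given before Constructor's move, Constructor's
-- edge, Blocker's edge.
Round : ℕ → Set
Round n = Family n × Edge n × Edge n

-- History: list of completed rounds, most recent first.
History : ℕ → Set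
History n = List (Round n)

cEdges : ∀ {n} → History n → List (Edge n)
cEdges h = map (λ r → proj₁ (proj₂ r)) h

bEdges : ∀ {n} → History n → List (Edge n)
bEdges h = map (λ r → proj₂ (proj₂ r)) h

ConStrategy : ℕ → Set
ConStrategy n = History n → Family n → Edge n

FamStrategy : ℕ → Set
FamStrategy n = History n → Family n

BlkStrategy : ℕ → Set
BlkStrategy n = History n → Family n → Edge n → Edge n

step : ∀ {n} → ConStrategy n → FamStrategy n → BlkStrategy n → History n → Round n
step σ φ β h = φ h , σ h (φ h) , β h (φ h) (σ h (φ h))

hist : ∀ {n} → ConStrategy n → FamStrategy n → BlkStrategy n → ℕ → History n
hist σ φ β zero = []
hist σ φ β (suc t) = step σ φ β (hist σ φ β t) ∷ hist σ φ β t

ConLegal : ∀ {n} → ℕ → History n → Family n → Edge n → Set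
ConLegal k h F c =
  Proper c × Unclaimed c (cEdges h ++ bEdges h) × (¬ Forbidden F c)
  × StarFree k (c ∷ cEdges h)

BlkLegal : ∀ {n} → History n → Edge n → Edge n → Set
BlkLegal h c b = Proper b × Unclaimed b (c ∷ (cEdges h ++ bEdges h))

RoundLegal : ∀ {n} → ℕ → ℕ → History n → Round n → Set
RoundLegal k C h (F , c , b) = ValidFamily C F × ConLegal k h F c × BlkLegal h c b

AdversaryCheats : ∀ {n} → ℕ → ℕ → History n → Round n → Set
AdversaryCheats k C h (F , c , b) =
  (¬ ValidFamily C F) ⊎ (ValidFamily C F × ConLegal k h F c × ¬ BlkLegal h c b)

-- conditions (1)-(3) for G_t[C] = cEdges h, G_t[B] = bEdges h
TargetReached : ∀ {n} → ℕ → ℚ → History n → Set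
TargetReached {n} k ε h =
  ((v : Fin n) → (deg v (cEdges h) ≡ k ∸ 1) ⊎ (deg v (cEdges h) ≡ k))
  × ((v : Fin n) → deg v (cEdges h) ≡ k ∸ 1 →
        ⟦ deg v (cEdges h ++ bEdges h) ⟧ ≤ℚ (ε * ⟦ n ⟧))
  × (⟦ length (filter (λ v → deg v (cEdges h) N.≟ k) (allFin n)) ⟧ ≤ℚ (ε * ⟦ n ⟧))

-- Outcome of a play: for some t, all rounds before t were legal for both
-- players, and either t ≥ 1 and (1)-(3) hold after round t, or the
-- adversary cheats in round t+1 while Constructor's move there is legal.
Wins : ∀ {n} → ℕ → ℕ → ℚ → ConStrategy n → FamStrategy n → BlkStrategy n → Set
Wins k C ε σ φ β =
  Σ ℕ λ t →
    ((i : ℕ) → i < t → RoundLegal k C (hist σ φ β i) (step σ φ β (hist σ φ β i)))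
    × ((1 ≤ t × TargetReached k ε (hist σ φ β t))
       ⊎ AdversaryCheats k C (hist σ φ β t) (step σ φ β (hist σ φ β t)))

{-# OPTIONS --safe #-}
-- Constructor always joins a vertex u of degree < k to a legal partner of degree < k: a heavy u
-- (total degree ≥ θ, θ a small fraction of n) if there is one, otherwise a deficient u (degree
-- < k − 1), preferring a deficient partner. Total degrees sum to O(nk), so only O(nk/θ) vertices
-- are ever heavy and there are O(k²·n/θ) heavy moves; hence every unsaturated vertex keeps total
-- degree θ + O(1). The excess Σ (deg − (k − 1))⁺ grows by 2 per heavy move, by 0 per move between
-- two deficient vertices and by 1 otherwise; the last kind only happens when fewer than 2θ + C
-- vertices are deficient and each such move lowers the deficit, so the excess stays O(kθ). A
-- pigeonhole count then always finds a partner. When no heavy or deficient vertex is left, every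
-- degree is k − 1 or k, vertices of degree k − 1 have total degree < θ ≤ εn, and vertices of
-- degree k number at most the excess ≤ εn.
module Submission where

open import Defs
open import Data.Bool using (true; false; if_then_else_)
open import Data.Empty using (⊥-elim)
open import Function using (_∘_; id)
open import Data.Fin using (Fin; zero; suc; _≟_)
open import Data.Fin.Properties using (any?; all?)
open import Data.Fin.Subset using (Subset; inside; outside; ∣_∣) renaming (_∈_ to _∈ₛ_)
open import Data.Fin.Subset.Properties using (_∈?_)
open import Data.List using (List; []; _∷_; _++_; length; filter; tabulate; allFin)
open import Data.List.Properties using (length-map)
open import Data.List.Relation.Unary.All using (All; []; _∷_)
import Data.Nat as ℕ
open import Data.Nat using (ℕ; zero; suc; _+_; _*_; _∸_; _/_; _%_; _≤_; _<_; z≤n; s≤s; _≤?_; _<?_)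
open import Data.Nat.DivMod using (m/n*n≤m; m≥n⇒m/n>0; m≡m%n+[m/n]*n; m%n<n)
open import Data.Nat.Properties hiding (_≟_)
open import Algebra.Properties.Semiring.Sum +-*-semiring
  using (sum; ∑-distrib-+; sum-cong-≗; *-distribˡ-sum; *-distribʳ-sum)
open import Data.Nat.Tactic.RingSolver using (solve-∀)
open import Data.Product using (Σ; ∃; ∃₂; _×_; _,_; proj₁; proj₂)
open import Data.Integer using (+[1+_])
import Data.Integer as ℤ
import Data.Integer.Properties as ℤ
open import Data.Rational using (ℚ; mkℚ; Positive; toℚᵘ) renaming (_≤_ to _≤ℚ_; _*_ to _*ℚ_)
import Data.Rational.Properties as ℚ
open import Data.Rational.Unnormalised using (mkℚᵘ; _≃_; *≤*)
import Data.Rational.Unnormalised.Properties as ℚᵘ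
open import Data.Sum using (_⊎_; inj₁; inj₂; [_,_]′)
open import Data.Vec using ([]; _∷_)
open import Relation.Nullary using (¬_; Dec; yes; no; does)
open import Relation.Nullary.Decidable using (_⊎-dec_; _×-dec_; _→-dec_; ¬?)
open import Relation.Binary.PropositionalEquality

𝟙 : ∀ {p} {P : Set p} → Dec P → ℕ
𝟙 d = if does d then 1 else 0

module _ {p} {P : Set p} where

  𝟙-yes : (d : Dec P) → P → 𝟙 d ≡ 1
  𝟙-yes (yes _) _ = refl
  𝟙-yes (no ¬p) p = ⊥-elim (¬p p)

  𝟙-no : (d : Dec P) → ¬ P → 𝟙 d ≡ 0
  𝟙-no (yes p) ¬p = ⊥-elim (¬p p)
  𝟙-no (no _) _ = refl

  𝟙≤1 : (d : Dec P) → 𝟙 d ≤ 1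
  𝟙≤1 (yes _) = s≤s z≤n
  𝟙≤1 (no _) = z≤n

𝟙-mono : ∀ {p q} {P : Set p} {Q : Set q} → (P → Q) → (P? : Dec P) (Q? : Dec Q) → 𝟙 P? ≤ 𝟙 Q?
𝟙-mono P⇒Q (yes p) (yes _) = ≤-refl
𝟙-mono P⇒Q (yes p) (no ¬q) = ⊥-elim (¬q (P⇒Q p))
𝟙-mono P⇒Q (no _) Q? = z≤n

sum-mono-≤ : ∀ {n} {f g : Fin n → ℕ} → (∀ i → f i ≤ g i) → sum f ≤ sum g
sum-mono-≤ {zero} f≤g = z≤n
sum-mono-≤ {suc n} f≤g = +-mono-≤ (f≤g zero) (sum-mono-≤ (f≤g ∘ suc))

sum-mono-< : ∀ {n} {f g : Fin n → ℕ} (j : Fin n) → (∀ i → f i ≤ g i) → f j < g j → sum f < sum g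
sum-mono-< zero f≤g fj<gj = +-mono-<-≤ fj<gj (sum-mono-≤ (f≤g ∘ suc))
sum-mono-< (suc j) f≤g fj<gj = +-mono-≤-< (f≤g zero) (sum-mono-< j (f≤g ∘ suc) fj<gj)

sum-const : ∀ {n} (c : ℕ) → sum {n} (λ _ → c) ≡ n * c
sum-const {zero} c = refl
sum-const {suc n} c = cong (c +_) (sum-const {n} c)

sum-0 : ∀ {n} → sum {n} (λ _ → 0) ≡ 0
sum-0 {n} = trans (sum-const {n} 0) (*-zeroʳ n)

sum-𝟙[≟]* : ∀ {n} (j : Fin n) (f : Fin n → ℕ) → sum (λ i → 𝟙 (i ≟ j) * f i) ≡ f j
sum-𝟙[≟]* {suc n} zero f = begin
  f zero + 0 + sum {n} (λ _ → 0) ≡⟨ cong (f zero + 0 +_) (sum-0 {n}) ⟩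
  f zero + 0 + 0                 ≡⟨ trans (+-identityʳ _) (+-identityʳ _) ⟩
  f zero                         ∎
  where open ≡-Reasoning
sum-𝟙[≟]* {suc n} (suc j) f = sum-𝟙[≟]* j (f ∘ suc)

sum-𝟙[≟] : ∀ {n} (j : Fin n) → sum (λ i → 𝟙 (i ≟ j)) ≡ 1
sum-𝟙[≟] j = trans (sum-cong-≗ (λ i → sym (*-identityʳ (𝟙 (i ≟ j))))) (sum-𝟙[≟]* j (λ _ → 1))

sum-𝟙[∈] : ∀ {n} (p : Subset n) → sum (λ i → 𝟙 (i ∈? p)) ≡ ∣ p ∣
sum-𝟙[∈] {zero} [] = refl
sum-𝟙[∈] {suc n} (inside ∷ p) = cong suc (sum-𝟙[∈] p)
sum-𝟙[∈] {suc n} (outside ∷ p) = sum-𝟙[∈] p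

length-filter-tabulate : ∀ {n p} {A : Set} {P : A → Set p} (P? : ∀ x → Dec (P x)) (f : Fin n → A) →
  length (filter P? (tabulate f)) ≡ sum (λ i → 𝟙 (P? (f i)))
length-filter-tabulate {zero} P? f = refl
length-filter-tabulate {suc n} P? f with does (P? (f zero))
... | true = cong suc (length-filter-tabulate P? (f ∘ suc))
... | false = length-filter-tabulate P? (f ∘ suc)

∃-if-sum< : ∀ {n p} {P : Fin n → Set p} (P? : ∀ i → Dec (P i)) (g B : Fin n → ℕ) →
  (∀ i → g i ≤ 𝟙 (P? i) + B i) → sum B < sum g → ∃ P
∃-if-sum< P? g B g≤ B<g with any? P?
... | yes ∃P = ∃P
... | no ¬∃P = ⊥-elim (<⇒≱ B<g (sum-mono-≤ λ i → ≤-trans (g≤ i)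
        (≤-reflexive (cong (_+ B i) (𝟙-no (P? i) (λ p → ¬∃P (i , p)))))))

incident? : ∀ {n} (v : Fin n) (e : Edge n) → Dec (Incident v e)
incident? v (a , b) = (v ≟ a) ⊎-dec (v ≟ b)

module _ {n : ℕ} where

  deg-∷ : ∀ (v : Fin n) e es → deg v (e ∷ es) ≡ 𝟙 (incident? v e) + deg v es
  deg-∷ v (a , b) es with does ((v ≟ a) ⊎-dec (v ≟ b))
  ... | true = refl
  ... | false = refl

  deg-++ : ∀ (v : Fin n) xs ys → deg v (xs ++ ys) ≡ deg v xs + deg v ys
  deg-++ v [] ys = refl
  deg-++ v (x ∷ xs) ys = begin
    deg v (x ∷ xs ++ ys)                       ≡⟨ deg-∷ v x (xs ++ ys) ⟩
    𝟙 (incident? v x) + deg v (xs ++ ys)       ≡⟨ cong (𝟙 (incident? v x) +_) (deg-++ v xs ys) ⟩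
    𝟙 (incident? v x) + (deg v xs + deg v ys)  ≡⟨ +-assoc (𝟙 (incident? v x)) _ _ ⟨
    𝟙 (incident? v x) + deg v xs + deg v ys    ≡⟨ cong (_+ deg v ys) (deg-∷ v x xs) ⟨
    deg v (x ∷ xs) + deg v ys                  ∎
    where open ≡-Reasoning

  deg-∷-mono : ∀ (v : Fin n) e es → deg v es ≤ deg v (e ∷ es)
  deg-∷-mono v e es = ≤-trans (m≤n+m _ _) (≤-reflexive (sym (deg-∷ v e es)))

  deg-∷-incident : ∀ {v : Fin n} {e} es → Incident v e → deg v (e ∷ es) ≡ suc (deg v es)
  deg-∷-incident {v} {e} es v∈e = trans (deg-∷ v e es) (cong (_+ deg v es) (𝟙-yes (incident? v e) v∈e))

  deg-∷-nonincident : ∀ {v : Fin n} {e} es → ¬ Incident v e → deg v (e ∷ es) ≡ deg v es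
  deg-∷-nonincident {v} {e} es v∉e = trans (deg-∷ v e es) (cong (_+ deg v es) (𝟙-no (incident? v e) v∉e))

  deg-∷-++-∷ : ∀ (v : Fin n) c cs b bs →
    deg v (c ∷ cs ++ b ∷ bs) ≡ deg v (cs ++ bs) + (𝟙 (incident? v c) + 𝟙 (incident? v b))
  deg-∷-++-∷ v c cs b bs = begin
    deg v (c ∷ cs ++ b ∷ bs)               ≡⟨ deg-∷ v c (cs ++ b ∷ bs) ⟩
    ic + deg v (cs ++ b ∷ bs)              ≡⟨ cong (ic +_) (deg-++ v cs (b ∷ bs)) ⟩
    ic + (deg v cs + deg v (b ∷ bs))       ≡⟨ cong (λ x → ic + (deg v cs + x)) (deg-∷ v b bs) ⟩
    ic + (deg v cs + (ib + deg v bs))      ≡⟨ rearrange ic (deg v cs) ib (deg v bs) ⟩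
    (deg v cs + deg v bs) + (ic + ib)      ≡⟨ cong (_+ (ic + ib)) (deg-++ v cs bs) ⟨
    deg v (cs ++ bs) + (ic + ib)           ∎
    where
    open ≡-Reasoning
    ic = 𝟙 (incident? v c)
    ib = 𝟙 (incident? v b)
    rearrange : ∀ i x j y → i + (x + (j + y)) ≡ (x + y) + (i + j)
    rearrange = solve-∀

  deg-∷-++-∷-mono : ∀ (v : Fin n) c cs b bs → deg v (cs ++ bs) ≤ deg v (c ∷ cs ++ b ∷ bs)
  deg-∷-++-∷-mono v c cs b bs = ≤-trans (m≤m+n _ _) (≤-reflexive (sym (deg-∷-++-∷ v c cs b bs)))

  deg-∷-++-∷-≤ : ∀ (v : Fin n) c cs b bs → deg v (c ∷ cs ++ b ∷ bs) ≤ deg v (cs ++ bs) + 2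
  deg-∷-++-∷-≤ v c cs b bs = ≤-trans (≤-reflexive (deg-∷-++-∷ v c cs b bs))
    (+-monoʳ-≤ (deg v (cs ++ bs)) (+-mono-≤ (𝟙≤1 (incident? v c)) (𝟙≤1 (incident? v b))))

  𝟙-incident≤ : ∀ (w a b : Fin n) → 𝟙 (incident? w (a , b)) ≤ 𝟙 (w ≟ a) + 𝟙 (w ≟ b)
  𝟙-incident≤ w a b with w ≟ a | w ≟ b
  ... | yes _ | yes _ = s≤s z≤n
  ... | yes _ | no _ = s≤s z≤n
  ... | no _ | yes _ = s≤s z≤n
  ... | no _ | no _ = z≤n

  𝟙-incident-proper : ∀ (w a b : Fin n) → a ≢ b → 𝟙 (incident? w (a , b)) ≡ 𝟙 (w ≟ a) + 𝟙 (w ≟ b)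
  𝟙-incident-proper w a b a≢b with w ≟ a | w ≟ b
  ... | yes refl | yes refl = ⊥-elim (a≢b refl)
  ... | yes _ | no _ = refl
  ... | no _ | yes _ = refl
  ... | no _ | no _ = refl

  sum-𝟙-incident≤2 : ∀ (e : Edge n) → sum (λ w → 𝟙 (incident? w e)) ≤ 2
  sum-𝟙-incident≤2 (a , b) = begin
    sum (λ w → 𝟙 (incident? w (a , b)))            ≤⟨ sum-mono-≤ (λ w → 𝟙-incident≤ w a b) ⟩
    sum (λ w → 𝟙 (w ≟ a) + 𝟙 (w ≟ b))              ≡⟨ ∑-distrib-+ (λ w → 𝟙 (w ≟ a)) (λ w → 𝟙 (w ≟ b)) ⟩
    sum (λ w → 𝟙 (w ≟ a)) + sum (λ w → 𝟙 (w ≟ b))  ≡⟨ cong₂ _+_ (sum-𝟙[≟] a) (sum-𝟙[≟] b) ⟩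
    2                                              ∎
    where open ≤-Reasoning

  sum-𝟙-incident-proper : ∀ (e : Edge n) → Proper e → sum (λ w → 𝟙 (incident? w e)) ≡ 2
  sum-𝟙-incident-proper (a , b) a≢b = begin
    sum (λ w → 𝟙 (incident? w (a , b)))            ≡⟨ sum-cong-≗ (λ w → 𝟙-incident-proper w a b a≢b) ⟩
    sum (λ w → 𝟙 (w ≟ a) + 𝟙 (w ≟ b))              ≡⟨ ∑-distrib-+ (λ w → 𝟙 (w ≟ a)) (λ w → 𝟙 (w ≟ b)) ⟩
    sum (λ w → 𝟙 (w ≟ a)) + sum (λ w → 𝟙 (w ≟ b))  ≡⟨ cong₂ _+_ (sum-𝟙[≟] a) (sum-𝟙[≟] b) ⟩
    2                                              ∎
    where open ≡-Reasoning

  sum-deg-∷ : ∀ e (es : List (Edge n)) →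
    sum (λ w → deg w (e ∷ es)) ≡ sum (λ w → 𝟙 (incident? w e)) + sum (λ w → deg w es)
  sum-deg-∷ e es = trans (sum-cong-≗ (λ w → deg-∷ w e es)) (∑-distrib-+ (λ w → 𝟙 (incident? w e)) _)

  sum-deg≤ : ∀ (es : List (Edge n)) → sum (λ w → deg w es) ≤ 2 * length es
  sum-deg≤ [] = ≤-reflexive (sum-0 {n})
  sum-deg≤ (e ∷ es) = begin
    sum (λ w → deg w (e ∷ es))  ≡⟨ sum-deg-∷ e es ⟩
    sum (λ w → 𝟙 (incident? w e)) + sum (λ w → deg w es)
      ≤⟨ +-mono-≤ (sum-𝟙-incident≤2 e) (sum-deg≤ es) ⟩
    2 + 2 * length es           ≡⟨ *-suc 2 (length es) ⟨
    2 * length (e ∷ es)         ∎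
    where open ≤-Reasoning

  sum-deg-proper : ∀ {es : List (Edge n)} → All Proper es → sum (λ w → deg w es) ≡ 2 * length es
  sum-deg-proper [] = sum-0 {n}
  sum-deg-proper {e ∷ es} (e-proper ∷ es-proper) = begin
    sum (λ w → deg w (e ∷ es))  ≡⟨ sum-deg-∷ e es ⟩
    sum (λ w → 𝟙 (incident? w e)) + sum (λ w → deg w es)
      ≡⟨ cong₂ _+_ (sum-𝟙-incident-proper e e-proper) (sum-deg-proper es-proper) ⟩
    2 + 2 * length es           ≡⟨ *-suc 2 (length es) ⟨
    2 * length (e ∷ es)         ∎
    where open ≡-Reasoning

  _≈ₑ?_ : ∀ (e f : Edge n) → Dec (e ≈ₑ f)
  (u , v) ≈ₑ? (x , y) = ((u ≟ x) ×-dec (v ≟ y)) ⊎-dec ((u ≟ y) ×-dec (v ≟ x))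

  unclaimed? : ∀ (e : Edge n) es → Dec (Unclaimed e es)
  unclaimed? e [] = yes _
  unclaimed? e (f ∷ es) = ¬? (e ≈ₑ? f) ×-dec unclaimed? e es

  claims : Fin n → Fin n → List (Edge n) → ℕ
  claims u w [] = 0
  claims u w (f ∷ es) = 𝟙 ((u , w) ≈ₑ? f) + claims u w es

  1≤claims : ∀ (u w : Fin n) es → ¬ Unclaimed (u , w) es → 1 ≤ claims u w es
  1≤claims u w [] claimed = ⊥-elim (claimed _)
  1≤claims u w (f ∷ es) claimed with (u , w) ≈ₑ? f
  ... | yes uw≈f = ≤-trans (≤-reflexive (sym (𝟙-yes ((u , w) ≈ₑ? f) uw≈f))) (m≤m+n _ _)
  ... | no uw≉f = ≤-trans (1≤claims u w es (λ unclaimed → claimed (uw≉f , unclaimed))) (m≤n+m _ _)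

  𝟙-≈ₑ≤ : ∀ (u w : Fin n) e → 𝟙 ((u , w) ≈ₑ? e) ≤ 𝟙 (incident? u e) * 𝟙 (incident? w e)
  𝟙-≈ₑ≤ u w (a , b) = bound ((u , w) ≈ₑ? (a , b))
    where
    both-incident : Incident u (a , b) → Incident w (a , b) →
      1 ≤ 𝟙 (incident? u (a , b)) * 𝟙 (incident? w (a , b))
    both-incident u∈e w∈e =
      ≤-reflexive (sym (cong₂ _*_ (𝟙-yes (incident? u (a , b)) u∈e) (𝟙-yes (incident? w (a , b)) w∈e)))
    bound : (d : Dec ((u , w) ≈ₑ (a , b))) → 𝟙 d ≤ 𝟙 (incident? u (a , b)) * 𝟙 (incident? w (a , b))
    bound (no _) = z≤n
    bound (yes (inj₁ (u≡a , w≡b))) = both-incident (inj₁ u≡a) (inj₂ w≡b)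
    bound (yes (inj₂ (u≡b , w≡a))) = both-incident (inj₂ u≡b) (inj₁ w≡a)

  sum-claims≤ : ∀ (u : Fin n) es → sum (λ w → claims u w es) ≤ 2 * deg u es
  sum-claims≤ u [] = ≤-reflexive (sum-0 {n})
  sum-claims≤ u (e ∷ es) = begin
    sum (λ w → 𝟙 ((u , w) ≈ₑ? e) + claims u w es)
      ≡⟨ ∑-distrib-+ (λ w → 𝟙 ((u , w) ≈ₑ? e)) (λ w → claims u w es) ⟩
    sum (λ w → 𝟙 ((u , w) ≈ₑ? e)) + sum (λ w → claims u w es)
      ≤⟨ +-mono-≤ claims-of-e (sum-claims≤ u es) ⟩
    2 * iu + 2 * deg u es     ≡⟨ *-distribˡ-+ 2 iu (deg u es) ⟨
    2 * (iu + deg u es)       ≡⟨ cong (2 *_) (deg-∷ u e es) ⟨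
    2 * deg u (e ∷ es)        ∎
    where
    open ≤-Reasoning
    iu = 𝟙 (incident? u e)
    claims-of-e : sum (λ w → 𝟙 ((u , w) ≈ₑ? e)) ≤ 2 * iu
    claims-of-e = begin
      sum (λ w → 𝟙 ((u , w) ≈ₑ? e))          ≤⟨ sum-mono-≤ (λ w → 𝟙-≈ₑ≤ u w e) ⟩
      sum (λ w → iu * 𝟙 (incident? w e))     ≡⟨ *-distribˡ-sum iu (λ w → 𝟙 (incident? w e)) ⟨
      iu * sum (λ w → 𝟙 (incident? w e))     ≤⟨ *-monoʳ-≤ iu (sum-𝟙-incident≤2 e) ⟩
      iu * 2                                 ≡⟨ *-comm iu 2 ⟩
      2 * iu                                 ∎

  starFree-∷ : ∀ {k} {e} {es : List (Edge n)} →
    (∀ w → Incident w e → deg w es < k) → StarFree k es → StarFree k (e ∷ es)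
  starFree-∷ {e = e} {es} room es-free w with incident? w e
  ... | yes w∈e = ≤-trans (≤-reflexive (deg-∷-incident es w∈e)) (room w w∈e)
  ... | no w∉e = ≤-trans (≤-reflexive (deg-∷-nonincident es w∉e)) (es-free w)

-- Excess, deficit and busy vertices

i+d∸r≤d∸r+i*[r≤d] : ∀ {i} d r → i ≤ 1 → (i + d) ∸ r ≤ (d ∸ r) + i * 𝟙 (r ≤? d)
i+d∸r≤d∸r+i*[r≤d] d r z≤n = m≤m+n (d ∸ r) 0
i+d∸r≤d∸r+i*[r≤d] d r (s≤s z≤n) = ≤-trans (bound (r ≤? d)) (+-monoʳ-≤ (d ∸ r) (m≤m+n _ 0))
  where
  bound : (r≤?d : Dec (r ≤ d)) → suc d ∸ r ≤ (d ∸ r) + 𝟙 r≤?d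
  bound (yes r≤d) = ≤-reflexive (trans (+-∸-assoc 1 r≤d) (+-comm 1 (d ∸ r)))
  bound (no r≰d) = ≤-trans (≤-reflexive (m≤n⇒m∸n≡0 (≰⇒> r≰d))) z≤n

module _ {n : ℕ} (r : ℕ) where

  excess deficit : List (Edge n) → ℕ
  excess es = sum (λ w → deg w es ∸ r)
  deficit es = sum (λ w → r ∸ deg w es)

  excess-[] : excess [] ≡ 0
  excess-[] = trans (sum-cong-≗ {n} {λ _ → 0 ∸ r} {λ _ → 0} (λ _ → 0∸n≡0 r)) (sum-0 {n})

  excess-gain : ∀ (w : Fin n) e es →
    deg w (e ∷ es) ∸ r ≤ (deg w es ∸ r) + 𝟙 (incident? w e) * 𝟙 (r ≤? deg w es)
  excess-gain w e es = ≤-trans (≤-reflexive (cong (_∸ r) (deg-∷ w e es)))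
    (i+d∸r≤d∸r+i*[r≤d] (deg w es) r (𝟙≤1 (incident? w e)))

  excess-∷ : ∀ (a b : Fin n) es →
    excess ((a , b) ∷ es) ≤ excess es + (𝟙 (r ≤? deg a es) + 𝟙 (r ≤? deg b es))
  excess-∷ a b es = begin
    excess ((a , b) ∷ es)                                  ≤⟨ sum-mono-≤ (λ w → excess-gain w e es) ⟩
    sum (λ w → (deg w es ∸ r) + 𝟙 (incident? w e) * δ w)  ≡⟨ ∑-distrib-+ (λ w → deg w es ∸ r) _ ⟩
    excess es + sum (λ w → 𝟙 (incident? w e) * δ w)
      ≤⟨ +-monoʳ-≤ (excess es) (sum-mono-≤ (λ w → *-monoˡ-≤ (δ w) (𝟙-incident≤ w a b))) ⟩
    excess es + sum (λ w → (𝟙 (w ≟ a) + 𝟙 (w ≟ b)) * δ w) ≡⟨ cong (excess es +_) endpoints ⟩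
    excess es + (δ a + δ b)                                ∎
    where
    open ≤-Reasoning
    e = (a , b)
    δ : Fin n → ℕ
    δ x = 𝟙 (r ≤? deg x es)
    endpoints : sum (λ w → (𝟙 (w ≟ a) + 𝟙 (w ≟ b)) * δ w) ≡ δ a + δ b
    endpoints = begin-equality
      sum (λ w → (𝟙 (w ≟ a) + 𝟙 (w ≟ b)) * δ w)
        ≡⟨ sum-cong-≗ (λ w → *-distribʳ-+ (δ w) (𝟙 (w ≟ a)) (𝟙 (w ≟ b))) ⟩
      sum (λ w → 𝟙 (w ≟ a) * δ w + 𝟙 (w ≟ b) * δ w)
        ≡⟨ ∑-distrib-+ (λ w → 𝟙 (w ≟ a) * δ w) (λ w → 𝟙 (w ≟ b) * δ w) ⟩
      sum (λ w → 𝟙 (w ≟ a) * δ w) + sum (λ w → 𝟙 (w ≟ b) * δ w)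
        ≡⟨ cong₂ _+_ (sum-𝟙[≟]* a δ) (sum-𝟙[≟]* b δ) ⟩
      δ a + δ b ∎

  deficientCount : List (Edge n) → ℕ
  deficientCount es = sum (λ w → 𝟙 (deg w es <? r))

  deficit≤ : ∀ es → deficit es ≤ r * deficientCount es
  deficit≤ es = begin
    deficit es                              ≤⟨ sum-mono-≤ (λ w → bound (deg w es <? r)) ⟩
    sum (λ w → r * 𝟙 (deg w es <? r))       ≡⟨ *-distribˡ-sum r (λ w → 𝟙 (deg w es <? r)) ⟨
    r * deficientCount es                   ∎
    where
    open ≤-Reasoning
    bound : ∀ {d} (d<?r : Dec (d < r)) → r ∸ d ≤ r * 𝟙 d<?r
    bound {d} (yes _) = ≤-trans (m∸n≤m r d) (≤-reflexive (sym (*-identityʳ r)))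
    bound (no d≮r) = ≤-reflexive (trans (m≤n⇒m∸n≡0 (≮⇒≥ d≮r)) (sym (*-zeroʳ r)))

  deficit-∷-mono : ∀ e es → deficit (e ∷ es) ≤ deficit es
  deficit-∷-mono e es = sum-mono-≤ (λ w → ∸-monoʳ-≤ r (deg-∷-mono w e es))

  deficit-∷-< : ∀ {u e} es → Incident u e → deg u es < r → deficit (e ∷ es) < deficit es
  deficit-∷-< {u} {e} es u∈e u-low = sum-mono-< u (λ w → ∸-monoʳ-≤ r (deg-∷-mono w e es))
    (≤-trans (≤-reflexive (cong (λ d → suc (r ∸ d)) (deg-∷-incident es u∈e))) (∸-monoʳ-< (n<1+n _) u-low))

module _ {n : ℕ} (θ : ℕ) where

  busyCount busyDegSum : List (Edge n) → List (Edge n) → ℕ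
  busyCount cs bs = sum (λ w → 𝟙 (θ ≤? deg w (cs ++ bs)))
  busyDegSum cs bs = sum (λ w → 𝟙 (θ ≤? deg w (cs ++ bs)) * deg w cs)

  busyTerm-∷-mono : ∀ c cs b bs (w : Fin n) →
    𝟙 (θ ≤? deg w (cs ++ bs)) * deg w cs ≤ 𝟙 (θ ≤? deg w (c ∷ cs ++ b ∷ bs)) * deg w (c ∷ cs)
  busyTerm-∷-mono c cs b bs w = *-mono-≤
    (𝟙-mono (λ θ≤d → ≤-trans θ≤d (deg-∷-++-∷-mono w c cs b bs))
      (θ ≤? deg w (cs ++ bs)) (θ ≤? deg w (c ∷ cs ++ b ∷ bs)))
    (deg-∷-mono w c cs)

  busyDegSum-∷-mono : ∀ c cs b bs → busyDegSum cs bs ≤ busyDegSum (c ∷ cs) (b ∷ bs)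
  busyDegSum-∷-mono c cs b bs = sum-mono-≤ (busyTerm-∷-mono c cs b bs)

  busyDegSum-∷-< : ∀ {u} c cs b bs → Incident u c → θ ≤ deg u (cs ++ bs) →
    busyDegSum cs bs < busyDegSum (c ∷ cs) (b ∷ bs)
  busyDegSum-∷-< {u} c cs b bs u∈c u-busy = sum-mono-< u (busyTerm-∷-mono c cs b bs)
    (begin-strict
      𝟙 (θ ≤? deg u (cs ++ bs)) * deg u cs
        ≡⟨ cong (_* deg u cs) (𝟙-yes (θ ≤? deg u (cs ++ bs)) u-busy) ⟩
      1 * deg u cs
        <⟨ *-monoʳ-< 1 (≤-reflexive (sym (deg-∷-incident cs u∈c))) ⟩
      1 * deg u (c ∷ cs)
        ≡⟨ cong (_* deg u (c ∷ cs)) (𝟙-yes (θ ≤? deg u (c ∷ cs ++ b ∷ bs)) u-busy′) ⟨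
      𝟙 (θ ≤? deg u (c ∷ cs ++ b ∷ bs)) * deg u (c ∷ cs) ∎)
    where
    open ≤-Reasoning
    u-busy′ = ≤-trans u-busy (deg-∷-++-∷-mono u c cs b bs)

  busyCount*θ≤ : ∀ cs bs → busyCount cs bs * θ ≤ sum (λ w → deg w (cs ++ bs))
  busyCount*θ≤ cs bs = begin
    busyCount cs bs * θ                          ≡⟨ *-distribʳ-sum θ (λ w → 𝟙 (θ ≤? deg w (cs ++ bs))) ⟩
    sum (λ w → 𝟙 (θ ≤? deg w (cs ++ bs)) * θ)    ≤⟨ sum-mono-≤ (λ w → busy⇒θ≤ (θ ≤? deg w (cs ++ bs))) ⟩
    sum (λ w → deg w (cs ++ bs))                 ∎
    where
    open ≤-Reasoning
    busy⇒θ≤ : ∀ {d} (θ≤?d : Dec (θ ≤ d)) → 𝟙 θ≤?d * θ ≤ d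
    busy⇒θ≤ (yes θ≤d) = ≤-trans (≤-reflexive (+-identityʳ θ)) θ≤d
    busy⇒θ≤ (no _) = z≤n

  busyDegSum≤ : ∀ {k} cs bs → StarFree k cs → busyDegSum cs bs ≤ k * busyCount cs bs
  busyDegSum≤ {k} cs bs cs-free = begin
    busyDegSum cs bs                             ≤⟨ sum-mono-≤ (λ w → *-monoʳ-≤ (𝟙 (θ ≤? deg w (cs ++ bs))) (cs-free w)) ⟩
    sum (λ w → 𝟙 (θ ≤? deg w (cs ++ bs)) * k)    ≡⟨ *-distribʳ-sum k (λ w → 𝟙 (θ ≤? deg w (cs ++ bs))) ⟨
    busyCount cs bs * k                          ≡⟨ *-comm (busyCount cs bs) k ⟩
    k * busyCount cs bs                          ∎
    where open ≤-Reasoning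

-- Winning by maintaining an invariant

validFamily? : ∀ {n} C (F : Family n) → Dec (ValidFamily C F)
validFamily? C F = all? (λ v → ∣ F v ∣ ≤? C) ×-dec
  all? (λ u → all? (λ v → ((u ∈? F v) →-dec (v ∈? F u)) ×-dec ((v ∈? F u) →-dec (u ∈? F v))))

blkLegal? : ∀ {n} (h : History n) c b → Dec (BlkLegal h c b)
blkLegal? h c (x , y) = ¬? (x ≟ y) ×-dec unclaimed? (x , y) (c ∷ (cEdges h ++ bEdges h))

length-hist : ∀ {n} (σ : ConStrategy n) φ β t → length (hist σ φ β t) ≡ t
length-hist σ φ β zero = refl
length-hist σ φ β (suc t) = cong suc (length-hist σ φ β t)

record WinningInvariant {n} (k C : ℕ) (ε : ℚ) (σ : ConStrategy n) : Set₁ where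
  field
    Inv       : History n → Set
    Continue  : History n → Set
    continue? : ∀ h → Dec (Continue h)
    initial   : Inv []
    respond   : ∀ h F → Inv h → h ≡ [] ⊎ Continue h → ValidFamily C F →
                ConLegal k h F (σ h F) × (∀ b → Inv ((F , σ h F , b) ∷ h))
    finish    : ∀ h → Inv h → ¬ Continue h → TargetReached k ε h
    maxRounds : ℕ
    bounded   : ∀ h → Inv h → length h ≤ maxRounds

module _ {n k C ε} {σ : ConStrategy n} (W : WinningInvariant k C ε σ)
         (φ : FamStrategy n) (β : BlkStrategy n) where

  open WinningInvariant W

  private
    H : ℕ → History n
    H = hist σ φ β

    LegalBefore : ℕ → Set
    LegalBefore t = ∀ i → i < t → RoundLegal k C (H i) (step σ φ β (H i))

    Alive : ℕ → Set
    Alive t = LegalBefore t × Inv (H t)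

    playRound : ∀ t → Alive t → H t ≡ [] ⊎ Continue (H t) → Wins k C ε σ φ β ⊎ Alive (suc t)
    playRound t (legal , inv) going = checkFamily (validFamily? C F)
      where
      F = φ (H t)
      c = σ (H t) F
      b = β (H t) F c

      checkFamily : Dec (ValidFamily C F) → Wins k C ε σ φ β ⊎ Alive (suc t)
      checkFamily (no ¬valid) = inj₁ (t , legal , inj₂ (inj₁ ¬valid))
      checkFamily (yes valid) = checkBlocker (blkLegal? (H t) c b)
        where
        response = respond (H t) F inv going valid

        checkBlocker : Dec (BlkLegal (H t) c b) → Wins k C ε σ φ β ⊎ Alive (suc t)
        checkBlocker (no ¬blkLegal) = inj₁ (t , legal , inj₂ (inj₂ (valid , proj₁ response , ¬blkLegal)))
        checkBlocker (yes blkLegal) = inj₂ (legal′ , proj₂ response b)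
          where
          legal′ : LegalBefore (suc t)
          legal′ i (s≤s i≤t) with m≤n⇒m<n∨m≡n i≤t
          ... | inj₁ i<t = legal i i<t
          ... | inj₂ refl = valid , proj₁ response , blkLegal

    advance : ∀ t → Alive t → Wins k C ε σ φ β ⊎ Alive (suc t)
    advance zero alive = playRound zero alive (inj₁ refl)
    advance (suc t) alive = checkContinue (continue? (H (suc t)))
      where
      checkContinue : Dec (Continue (H (suc t))) → Wins k C ε σ φ β ⊎ Alive (suc (suc t))
      checkContinue (yes going) = playRound (suc t) alive (inj₂ going)
      checkContinue (no stop) = inj₁ (suc t , proj₁ alive , inj₁ (s≤s z≤n , finish (H (suc t)) (proj₂ alive) stop))

    play : ∀ t → Wins k C ε σ φ β ⊎ Alive t
    play zero = inj₂ ((λ _ ()) , initial)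
    play (suc t) = [ inj₁ , advance t ]′ (play t)

  invariant⇒wins : Wins k C ε σ φ β
  invariant⇒wins = [ id , (λ alive → ⊥-elim (1+n≰n (outlived alive))) ]′ (play (suc maxRounds))
    where
    outlived : Alive (suc maxRounds) → suc maxRounds ≤ maxRounds
    outlived (_ , inv) = ≤-trans (≤-reflexive (sym (length-hist σ φ β (suc maxRounds)))) (bounded _ inv)

-- Constructor's strategy

module Strategy (n′ k′ C θ : ℕ) where

  n k L : ℕ
  n = suc n′
  k = suc k′
  L = 2 * θ + C

  Graph : Set
  Graph = List (Edge n)

  Heavy : Graph → Graph → Fin n → Set
  Heavy cs bs u = θ ≤ deg u (cs ++ bs) × deg u cs < k

  heavy? : ∀ cs bs u → Dec (Heavy cs bs u)
  heavy? cs bs u = (θ ≤? deg u (cs ++ bs)) ×-dec (deg u cs <? k)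

  Deficient : Graph → Fin n → Set
  Deficient cs u = deg u cs < k′

  deficient? : ∀ cs u → Dec (Deficient cs u)
  deficient? cs u = deg u cs <? k′

  Available : Graph → Graph → Family n → Fin n → Fin n → Set
  Available cs bs F u v = u ≢ v × Unclaimed (u , v) (cs ++ bs) × ¬ u ∈ₛ F v × deg v cs < k

  available? : ∀ cs bs F u v → Dec (Available cs bs F u v)
  available? cs bs F u v =
    ¬? (u ≟ v) ×-dec unclaimed? (u , v) (cs ++ bs) ×-dec ¬? (u ∈? F v) ×-dec (deg v cs <? k)

  AvailableDeficient : Graph → Graph → Family n → Fin n → Fin n → Set
  AvailableDeficient cs bs F u v = Available cs bs F u v × Deficient cs v

  availableDeficient? : ∀ cs bs F u v → Dec (AvailableDeficient cs bs F u v)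
  availableDeficient? cs bs F u v = available? cs bs F u v ×-dec deficient? cs v

  witnessOr : ∀ {P : Fin n → Set} → Dec (∃ P) → Fin n → Fin n
  witnessOr (yes (v , _)) _ = v
  witnessOr (no _) u = u

  witnessOr-sound : ∀ {P : Fin n → Set} (P? : Dec (∃ P)) u → ∃ P → P (witnessOr P? u)
  witnessOr-sound (yes (v , p)) u _ = p
  witnessOr-sound (no ¬∃P) u ∃P = ⊥-elim (¬∃P ∃P)

  partner : Graph → Graph → Family n → Fin n → Fin n
  partner cs bs F u = witnessOr (any? (available? cs bs F u)) u

  choose : ∀ cs bs → Family n → Dec (∃ (Heavy cs bs)) → Dec (∃ (Deficient cs)) → Edge n
  choose cs bs F (yes (u , _)) _ = u , partner cs bs F u
  choose cs bs F (no _) (yes (u , _)) = u , witnessOr (any? (availableDeficient? cs bs F u)) (partner cs bs F u)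
  choose cs bs F (no _) (no _) = zero , partner cs bs F zero  -- only used for the opening move

  strategy : ConStrategy n
  strategy h F = choose (cEdges h) (bEdges h) F (any? (heavy? (cEdges h) (bEdges h))) (any? (deficient? (cEdges h)))

  -- a counts the moves made at a heavy vertex, b the moves joining a
  -- deficient vertex to a non-deficient one while no heavy vertex exists.
  record Invariant (cs bs : Graph) (a b : ℕ) : Set where
    field
      proper          : All Proper cs
      starFree        : StarFree k cs
      balanced        : length bs ≡ length cs
      unsaturatedLoad : ∀ u → deg u cs < k → deg u (cs ++ bs) ≤ θ + suc (2 * a)
      heavyMoves      : a ≤ busyDegSum θ cs bs
      excessBound     : excess k′ cs ≤ 2 + 2 * a + b
      deficitBound    : b ≡ 0 ⊎ b + deficit k′ cs ≤ k′ * L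

  LegalMove : Graph → Graph → Family n → Edge n → Set
  LegalMove cs bs F c = Proper c × Unclaimed c (cs ++ bs) × ¬ Forbidden F c × StarFree k (c ∷ cs)

  module Move {cs bs a b} (I : Invariant cs bs a b) {F u v}
              (avail : Available cs bs F u v) (u-unsaturated : deg u cs < k) where

    open Invariant I

    legal : LegalMove cs bs F (u , v)
    legal = proj₁ avail , proj₁ (proj₂ avail) , proj₁ (proj₂ (proj₂ avail)) , starFree-∷ room starFree
      where
      room : ∀ w → Incident w (u , v) → deg w cs < k
      room w (inj₁ refl) = u-unsaturated
      room w (inj₂ refl) = proj₂ (proj₂ (proj₂ avail))

    module _ (blk : Edge n) where

      cs′ bs′ : Graph
      cs′ = (u , v) ∷ cs
      bs′ = blk ∷ bs

      extend : ∀ {a′ b′} →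
        (∀ w → deg w cs′ < k → deg w (cs′ ++ bs′) ≤ θ + suc (2 * a′)) → a′ ≤ busyDegSum θ cs′ bs′ →
        excess k′ cs′ ≤ 2 + 2 * a′ + b′ → b′ ≡ 0 ⊎ b′ + deficit k′ cs′ ≤ k′ * L → Invariant cs′ bs′ a′ b′
      extend load moves exc def = record
        { proper = proj₁ avail ∷ proper ; starFree = proj₂ (proj₂ (proj₂ legal)) ; balanced = cong suc balanced
        ; unsaturatedLoad = load ; heavyMoves = moves ; excessBound = exc ; deficitBound = def }

      unsaturated-before : ∀ w → deg w cs′ < k → deg w cs < k
      unsaturated-before w = ≤-<-trans (deg-∷-mono w (u , v) cs)

      heavyMoves′ : a ≤ busyDegSum θ cs′ bs′
      heavyMoves′ = ≤-trans heavyMoves (busyDegSum-∷-mono θ (u , v) cs blk bs)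

      deficitBound′ : b ≡ 0 ⊎ b + deficit k′ cs′ ≤ k′ * L
      deficitBound′ with deficitBound
      ... | inj₁ b≡0 = inj₁ b≡0
      ... | inj₂ b+def≤ = inj₂ (≤-trans (+-monoʳ-≤ b (deficit-∷-mono k′ (u , v) cs)) b+def≤)

      excess′ : excess k′ cs′ ≤ excess k′ cs + (𝟙 (k′ ≤? deg u cs) + 𝟙 (k′ ≤? deg v cs))
      excess′ = excess-∷ k′ u v cs

      calmLoad : (∀ w → ¬ Heavy cs bs w) → ∀ w → deg w cs′ < k → deg w (cs′ ++ bs′) ≤ θ + suc (2 * a)
      calmLoad calm w w-unsaturated = begin
        deg w (cs′ ++ bs′)          ≤⟨ deg-∷-++-∷-≤ w (u , v) cs blk bs ⟩
        deg w (cs ++ bs) + 2        ≡⟨ +-suc (deg w (cs ++ bs)) 1 ⟩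
        suc (deg w (cs ++ bs)) + 1  ≤⟨ +-monoˡ-≤ 1 light ⟩
        θ + 1                       ≤⟨ +-monoʳ-≤ θ (s≤s z≤n) ⟩
        θ + suc (2 * a)             ∎
        where
        open ≤-Reasoning
        light : deg w (cs ++ bs) < θ
        light = ≰⇒> (λ busy → calm w (busy , unsaturated-before w w-unsaturated))

      firstMove : cs ≡ [] → bs ≡ [] → 1 ≤ θ → Invariant cs′ bs′ a b
      firstMove cs≡[] bs≡[] 1≤θ = extend load heavyMoves′ exc deficitBound′
        where
        load : ∀ w → deg w cs′ < k → deg w (cs′ ++ bs′) ≤ θ + suc (2 * a)
        load w _ = begin
          deg w (cs′ ++ bs′)     ≤⟨ deg-∷-++-∷-≤ w (u , v) cs blk bs ⟩
          deg w (cs ++ bs) + 2   ≡⟨ cong₂ (λ xs ys → deg w (xs ++ ys) + 2) cs≡[] bs≡[] ⟩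
          2                      ≤⟨ +-mono-≤ 1≤θ (s≤s z≤n) ⟩
          θ + suc (2 * a)        ∎
          where open ≤-Reasoning
        exc : excess k′ cs′ ≤ 2 + 2 * a + b
        exc = begin
          excess k′ cs′     ≤⟨ excess′ ⟩
          excess k′ cs + (𝟙 (k′ ≤? deg u cs) + 𝟙 (k′ ≤? deg v cs))
                            ≤⟨ +-mono-≤ (≤-reflexive excess₀) (+-mono-≤ (𝟙≤1 (k′ ≤? deg u cs)) (𝟙≤1 (k′ ≤? deg v cs))) ⟩
          2                 ≤⟨ m≤m+n 2 (2 * a) ⟩
          2 + 2 * a         ≤⟨ m≤m+n (2 + 2 * a) b ⟩
          2 + 2 * a + b     ∎
          where
          open ≤-Reasoning
          excess₀ : excess k′ cs ≡ 0
          excess₀ = trans (cong (excess k′) cs≡[]) (excess-[] {n} k′)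

      heavyMove : Heavy cs bs u → Invariant cs′ bs′ (suc a) b
      heavyMove (u-busy , _) =
        extend load (≤-<-trans heavyMoves (busyDegSum-∷-< θ (u , v) cs blk bs (inj₁ refl) u-busy)) exc deficitBound′
        where
        load : ∀ w → deg w cs′ < k → deg w (cs′ ++ bs′) ≤ θ + suc (2 * suc a)
        load w w-unsaturated = begin
          deg w (cs′ ++ bs′)          ≤⟨ deg-∷-++-∷-≤ w (u , v) cs blk bs ⟩
          deg w (cs ++ bs) + 2        ≤⟨ +-monoˡ-≤ 2 (unsaturatedLoad w (unsaturated-before w w-unsaturated)) ⟩
          θ + suc (2 * a) + 2         ≡⟨ shift θ a ⟩
          θ + suc (2 * suc a)         ∎
          where
          open ≤-Reasoning
          shift : ∀ θ a → θ + suc (2 * a) + 2 ≡ θ + suc (2 * suc a)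
          shift = solve-∀
        exc : excess k′ cs′ ≤ 2 + 2 * suc a + b
        exc = begin
          excess k′ cs′       ≤⟨ excess′ ⟩
          excess k′ cs + (𝟙 (k′ ≤? deg u cs) + 𝟙 (k′ ≤? deg v cs))
                              ≤⟨ +-mono-≤ excessBound (+-mono-≤ (𝟙≤1 (k′ ≤? deg u cs)) (𝟙≤1 (k′ ≤? deg v cs))) ⟩
          2 + 2 * a + b + 2   ≡⟨ shift a b ⟩
          2 + 2 * suc a + b   ∎
          where
          open ≤-Reasoning
          shift : ∀ a b → 2 + 2 * a + b + 2 ≡ 2 + 2 * suc a + b
          shift = solve-∀

      pairedMove : (∀ w → ¬ Heavy cs bs w) → Deficient cs u → Deficient cs v → Invariant cs′ bs′ a b
      pairedMove calm u-deficient v-deficient = extend (calmLoad calm) heavyMoves′ exc deficitBound′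
        where
        exc : excess k′ cs′ ≤ 2 + 2 * a + b
        exc = begin
          excess k′ cs′      ≤⟨ excess′ ⟩
          excess k′ cs + (𝟙 (k′ ≤? deg u cs) + 𝟙 (k′ ≤? deg v cs))
                             ≡⟨ cong (excess k′ cs +_) (cong₂ _+_ (𝟙-no (k′ ≤? deg u cs) (<⇒≱ u-deficient))
                                                                (𝟙-no (k′ ≤? deg v cs) (<⇒≱ v-deficient))) ⟩
          excess k′ cs + 0   ≡⟨ +-identityʳ (excess k′ cs) ⟩
          excess k′ cs       ≤⟨ excessBound ⟩
          2 + 2 * a + b      ∎
          where open ≤-Reasoning

      singleMove : (∀ w → ¬ Heavy cs bs w) → Deficient cs u → deficientCount k′ cs < L → Invariant cs′ bs′ a (suc b)
      singleMove calm u-deficient few = extend (calmLoad calm) heavyMoves′ exc (inj₂ def)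
        where
        exc : excess k′ cs′ ≤ 2 + 2 * a + suc b
        exc = begin
          excess k′ cs′      ≤⟨ excess′ ⟩
          excess k′ cs + (𝟙 (k′ ≤? deg u cs) + 𝟙 (k′ ≤? deg v cs))
                             ≡⟨ cong (λ x → excess k′ cs + (x + 𝟙 (k′ ≤? deg v cs))) (𝟙-no (k′ ≤? deg u cs) (<⇒≱ u-deficient)) ⟩
          excess k′ cs + 𝟙 (k′ ≤? deg v cs)
                             ≤⟨ +-mono-≤ excessBound (𝟙≤1 (k′ ≤? deg v cs)) ⟩
          2 + 2 * a + b + 1  ≡⟨ shift a b ⟩
          2 + 2 * a + suc b  ∎
          where
          open ≤-Reasoning
          shift : ∀ a b → 2 + 2 * a + b + 1 ≡ 2 + 2 * a + suc b
          shift = solve-∀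
        def : suc b + deficit k′ cs′ ≤ k′ * L
        def = begin
          suc b + deficit k′ cs′   ≡⟨ +-suc b (deficit k′ cs′) ⟨
          b + suc (deficit k′ cs′) ≤⟨ +-monoʳ-≤ b (deficit-∷-< k′ cs (inj₁ refl) u-deficient) ⟩
          b + deficit k′ cs        ≤⟨ earlier deficitBound ⟩
          k′ * L                   ∎
          where
          open ≤-Reasoning
          earlier : b ≡ 0 ⊎ b + deficit k′ cs ≤ k′ * L → b + deficit k′ cs ≤ k′ * L
          earlier (inj₂ b+def≤) = b+def≤
          earlier (inj₁ refl) = ≤-trans (deficit≤ k′ cs) (*-monoʳ-≤ k′ (<⇒≤ few))

  module _ {cs bs : Graph} {F : Family n} (valid : ValidFamily C F) (u : Fin n) where

    blockers : Fin n → ℕ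
    blockers w = 𝟙 (w ≟ u) + claims u w (cs ++ bs) + 𝟙 (w ∈? F u)

    unavailable⇒blocked : ∀ w → ¬ Available cs bs F u w → deg w cs < k → 1 ≤ blockers w
    unavailable⇒blocked w ¬avail w-unsaturated with u ≟ w
    ... | yes u≡w = ≤-trans (≤-reflexive (sym (𝟙-yes (w ≟ u) (sym u≡w)))) (≤-trans (m≤m+n _ _) (m≤m+n _ _))
    ... | no u≢w with unclaimed? (u , w) (cs ++ bs)
    ...   | no claimed = ≤-trans (1≤claims u w (cs ++ bs) claimed) (≤-trans (m≤n+m _ (𝟙 (w ≟ u))) (m≤m+n _ _))
    ...   | yes unclaimed with u ∈? F w
    ...     | yes u∈Fw = ≤-trans (≤-reflexive (sym (𝟙-yes (w ∈? F u) (proj₁ (proj₂ valid u w) u∈Fw)))) (m≤n+m _ _)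
    ...     | no u∉Fw = ⊥-elim (¬avail (u≢w , unclaimed , u∉Fw , w-unsaturated))

    sum-blockers≤ : sum blockers ≤ 1 + 2 * deg u (cs ++ bs) + C
    sum-blockers≤ = begin
      sum blockers
        ≡⟨ ∑-distrib-+ (λ w → 𝟙 (w ≟ u) + claims u w (cs ++ bs)) (λ w → 𝟙 (w ∈? F u)) ⟩
      sum (λ w → 𝟙 (w ≟ u) + claims u w (cs ++ bs)) + sum (λ w → 𝟙 (w ∈? F u))
        ≡⟨ cong₂ _+_ (∑-distrib-+ (λ w → 𝟙 (w ≟ u)) (λ w → claims u w (cs ++ bs))) (sum-𝟙[∈] (F u)) ⟩
      sum (λ w → 𝟙 (w ≟ u)) + sum (λ w → claims u w (cs ++ bs)) + ∣ F u ∣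
        ≤⟨ +-mono-≤ (+-mono-≤ (≤-reflexive (sum-𝟙[≟] u)) (sum-claims≤ u (cs ++ bs))) (proj₁ valid u) ⟩
      1 + 2 * deg u (cs ++ bs) + C ∎
      where open ≤-Reasoning

    -- Every vertex other than a partner is blocked or saturated, and saturated
    -- vertices each contribute to the excess.
    available-exists : 1 + 2 * deg u (cs ++ bs) + C + excess k′ cs < n → ∃ (Available cs bs F u)
    available-exists room = ∃-if-sum< (available? cs bs F u) (λ _ → 1) (λ w → blockers w + (deg w cs ∸ k′)) covered
      (begin-strict
        sum (λ w → blockers w + (deg w cs ∸ k′))  ≡⟨ ∑-distrib-+ blockers (λ w → deg w cs ∸ k′) ⟩
        sum blockers + excess k′ cs               ≤⟨ +-monoˡ-≤ (excess k′ cs) sum-blockers≤ ⟩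
        1 + 2 * deg u (cs ++ bs) + C + excess k′ cs <⟨ room ⟩
        n                                         ≡⟨ *-identityʳ n ⟨
        n * 1                                     ≡⟨ sum-const {n} 1 ⟨
        sum {n} (λ _ → 1)                         ∎)
      where
      open ≤-Reasoning
      covered : ∀ w → 1 ≤ 𝟙 (available? cs bs F u w) + (blockers w + (deg w cs ∸ k′))
      covered w = cover (available? cs bs F u w) (deg w cs <? k)
        where
        cover : (avail? : Dec (Available cs bs F u w)) → Dec (deg w cs < k) →
          1 ≤ 𝟙 avail? + (blockers w + (deg w cs ∸ k′))
        cover (yes _) _ = s≤s z≤n
        cover (no ¬avail) (yes w-unsaturated) = ≤-trans (unavailable⇒blocked w ¬avail w-unsaturated) (m≤m+n _ _)
        cover (no _) (no w-saturated) = ≤-trans (m<n⇒0<n∸m (≰⇒> (w-saturated ∘ s≤s))) (m≤n+m _ (blockers w))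

    availableDeficient-exists : deg u (cs ++ bs) < θ → L ≤ deficientCount k′ cs → ∃ (AvailableDeficient cs bs F u)
    availableDeficient-exists light many =
      ∃-if-sum< (availableDeficient? cs bs F u) (λ w → 𝟙 (deg w cs <? k′)) blockers covered
      (begin-strict
        sum blockers                  ≤⟨ sum-blockers≤ ⟩
        1 + 2 * deg u (cs ++ bs) + C
          <⟨ +-monoˡ-≤ C (≤-trans (≤-reflexive (sym (*-suc 2 (deg u (cs ++ bs))))) (*-monoʳ-≤ 2 light)) ⟩
        L                             ≤⟨ many ⟩
        deficientCount k′ cs          ∎)
      where
      open ≤-Reasoning
      covered : ∀ w → 𝟙 (deg w cs <? k′) ≤ 𝟙 (availableDeficient? cs bs F u w) + blockers w
      covered w = cover (deg w cs <? k′) (availableDeficient? cs bs F u w)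
        where
        cover : (deficient? : Dec (deg w cs < k′)) (avail? : Dec (AvailableDeficient cs bs F u w)) →
          𝟙 deficient? ≤ 𝟙 avail? + blockers w
        cover (no _) _ = z≤n
        cover (yes _) (yes _) = s≤s z≤n
        cover (yes w-deficient) (no ¬avail) =
          unavailable⇒blocked w (λ avail → ¬avail (avail , w-deficient)) (≤-trans w-deficient (n≤1+n k′))

  maxHeavyMoves maxExcess : ℕ → ℕ
  maxHeavyMoves maxBusy = k * maxBusy
  maxExcess maxBusy = 2 + 2 * maxHeavyMoves maxBusy + k′ * L

  module Analysis (maxBusy : ℕ) (busyCount-bound : ∀ x → x * θ ≤ 2 * (n * k) → x ≤ maxBusy)
                  (1≤θ : 1 ≤ θ) (room : 1 + 2 * (θ + suc (2 * maxHeavyMoves maxBusy)) + C + maxExcess maxBusy < n)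
                  (ε : ℚ) (d : ℕ) (≤ε*n : ∀ x → x * suc d ≤ n → ⟦ x ⟧ ≤ℚ ε *ℚ ⟦ n ⟧)
                  (θ-small : θ * suc d ≤ n) (excess-small : maxExcess maxBusy * suc d ≤ n) where

    module _ {cs bs a b} (I : Invariant cs bs a b) where

      open Invariant I

      2*length≤ : 2 * length cs ≤ n * k
      2*length≤ = begin
        2 * length cs           ≡⟨ sum-deg-proper proper ⟨
        sum (λ w → deg w cs)    ≤⟨ sum-mono-≤ starFree ⟩
        sum {n} (λ _ → k)       ≡⟨ sum-const {n} k ⟩
        n * k                   ∎
        where open ≤-Reasoning

      heavyMoves≤ : a ≤ maxHeavyMoves maxBusy
      heavyMoves≤ = begin
        a                       ≤⟨ heavyMoves ⟩
        busyDegSum θ cs bs      ≤⟨ busyDegSum≤ θ cs bs starFree ⟩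
        k * busyCount θ cs bs   ≤⟨ *-monoʳ-≤ k (busyCount-bound _ (≤-trans (busyCount*θ≤ θ cs bs) loadSum≤)) ⟩
        k * maxBusy             ∎
        where
        open ≤-Reasoning
        loadSum≤ : sum (λ w → deg w (cs ++ bs)) ≤ 2 * (n * k)
        loadSum≤ = begin
          sum (λ w → deg w (cs ++ bs))                  ≡⟨ sum-cong-≗ (λ w → deg-++ w cs bs) ⟩
          sum (λ w → deg w cs + deg w bs)               ≡⟨ ∑-distrib-+ (λ w → deg w cs) (λ w → deg w bs) ⟩
          sum (λ w → deg w cs) + sum (λ w → deg w bs)   ≤⟨ +-mono-≤ (≤-reflexive (sum-deg-proper proper)) (sum-deg≤ bs) ⟩
          2 * length cs + 2 * length bs                 ≡⟨ cong (λ l → 2 * length cs + 2 * l) balanced ⟩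
          2 * length cs + 2 * length cs                 ≤⟨ +-mono-≤ 2*length≤ 2*length≤ ⟩
          n * k + n * k                                 ≡⟨ cong (n * k +_) (+-identityʳ (n * k)) ⟨
          2 * (n * k)                                   ∎

      excess≤ : excess k′ cs ≤ maxExcess maxBusy
      excess≤ = ≤-trans excessBound (+-mono-≤ (+-monoʳ-≤ 2 (*-monoʳ-≤ 2 heavyMoves≤)) b≤)
        where
        b≤ : b ≤ k′ * L
        b≤ with deficitBound
        ... | inj₁ refl = z≤n
        ... | inj₂ b+def≤ = ≤-trans (m≤m+n b _) b+def≤

      room-at : ∀ u → deg u cs < k → 1 + 2 * deg u (cs ++ bs) + C + excess k′ cs < n
      room-at u u-unsaturated = ≤-<-trans
        (+-mono-≤ (+-monoˡ-≤ C (+-monoʳ-≤ 1 (*-monoʳ-≤ 2 load≤))) excess≤) room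
        where
        load≤ : deg u (cs ++ bs) ≤ θ + suc (2 * maxHeavyMoves maxBusy)
        load≤ = ≤-trans (unsaturatedLoad u u-unsaturated) (+-monoʳ-≤ θ (s≤s (*-monoʳ-≤ 2 heavyMoves≤)))

    Inv : History n → Set
    Inv h = ∃₂ λ a b → Invariant (cEdges h) (bEdges h) a b

    Continue : History n → Set
    Continue h = ∃ (Heavy (cEdges h) (bEdges h)) ⊎ ∃ (Deficient (cEdges h))

    initial : Inv []
    initial = 0 , 0 , record
      { proper = [] ; starFree = λ _ → z≤n ; balanced = refl ; unsaturatedLoad = λ _ _ → z≤n
      ; heavyMoves = z≤n ; excessBound = ≤-trans (≤-reflexive (excess-[] {n} k′)) z≤n ; deficitBound = inj₁ refl }

    respond : ∀ h F → Inv h → h ≡ [] ⊎ Continue h → ValidFamily C F →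
      ConLegal k h F (strategy h F) × (∀ b → Inv ((F , strategy h F , b) ∷ h))
    respond h F (a , b , I) going valid = respondTo (any? (heavy? cs bs)) (any? (deficient? cs)) (start-or going)
      where
      cs bs : Graph
      cs = cEdges h
      bs = bEdges h

      start-or : h ≡ [] ⊎ Continue h → (cs ≡ [] × bs ≡ []) ⊎ Continue h
      start-or (inj₁ h≡[]) = inj₁ (cong cEdges h≡[] , cong bEdges h≡[])
      start-or (inj₂ go) = inj₂ go

      partner-available : ∀ u → deg u cs < k → Available cs bs F u (partner cs bs F u)
      partner-available u u-unsaturated = witnessOr-sound (any? (available? cs bs F u)) u
        (available-exists {cs} {bs} valid u (room-at I u u-unsaturated))

      respondTo : (dH : Dec (∃ (Heavy cs bs))) (dD : Dec (∃ (Deficient cs))) → (cs ≡ [] × bs ≡ []) ⊎ Continue h →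
        ConLegal k h F (choose cs bs F dH dD) × (∀ blk → Inv ((F , choose cs bs F dH dD , blk) ∷ h))
      respondTo (yes (u , u-heavy)) _ _ = legal , λ blk → suc a , b , heavyMove blk u-heavy
        where
        u-unsaturated = proj₂ u-heavy
        open Move I {F} (partner-available u u-unsaturated) u-unsaturated using (legal; heavyMove)
      respondTo (no ¬heavy) (yes (u , u-deficient)) _ = pairOrSingle (any? (availableDeficient? cs bs F u))
        where
        calm : ∀ w → ¬ Heavy cs bs w
        calm w w-heavy = ¬heavy (w , w-heavy)
        u-unsaturated : deg u cs < k
        u-unsaturated = ≤-trans u-deficient (n≤1+n k′)
        pairOrSingle : (dAD : Dec (∃ (AvailableDeficient cs bs F u))) →
          ConLegal k h F (u , witnessOr dAD (partner cs bs F u)) ×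
          (∀ blk → Inv ((F , (u , witnessOr dAD (partner cs bs F u)) , blk) ∷ h))
        pairOrSingle (yes (v , avail , v-deficient)) = legal , λ blk → a , b , pairedMove blk calm u-deficient v-deficient
          where open Move I {F} avail u-unsaturated using (legal; pairedMove)
        pairOrSingle (no ¬availableDeficient) = legal , λ blk → a , suc b , singleMove blk calm u-deficient few
          where
          open Move I {F} (partner-available u u-unsaturated) u-unsaturated using (legal; singleMove)
          light : deg u (cs ++ bs) < θ
          light = ≰⇒> (λ u-busy → calm u (u-busy , u-unsaturated))
          few : deficientCount k′ cs < L
          few = ≰⇒> (λ many → ¬availableDeficient (availableDeficient-exists {cs} {bs} valid u light many))
      respondTo (no ¬heavy) (no ¬deficient) (inj₁ (cs≡[] , bs≡[])) =
        legal , λ blk → a , b , firstMove blk cs≡[] bs≡[] 1≤θ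
        where
        zero-unsaturated : deg zero cs < k
        zero-unsaturated = ≤-trans (≤-reflexive (cong (λ es → suc (deg zero es)) cs≡[])) (s≤s z≤n)
        open Move I {F} (partner-available zero zero-unsaturated) zero-unsaturated using (legal; firstMove)
      respondTo (no ¬heavy) (no _) (inj₂ (inj₁ heavy)) = ⊥-elim (¬heavy heavy)
      respondTo (no _) (no ¬deficient) (inj₂ (inj₂ deficient)) = ⊥-elim (¬deficient deficient)

    finish : ∀ h → Inv h → ¬ Continue h → TargetReached k ε h
    finish h (a , b , I) stop = degrees , light , fewSaturated
      where
      open Invariant I
      cs = cEdges h
      bs = bEdges h

      not-deficient : ∀ v → k′ ≤ deg v cs
      not-deficient v = ≮⇒≥ (λ v-deficient → stop (inj₂ (v , v-deficient)))

      degrees : ∀ v → deg v cs ≡ k′ ⊎ deg v cs ≡ k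
      degrees v with m≤n⇒m<n∨m≡n (not-deficient v)
      ... | inj₁ k′<deg = inj₂ (≤-antisym (starFree v) k′<deg)
      ... | inj₂ k′≡deg = inj₁ (sym k′≡deg)

      light : ∀ v → deg v cs ≡ k′ → ⟦ deg v (cs ++ bs) ⟧ ≤ℚ ε *ℚ ⟦ n ⟧
      light v deg≡k′ = ≤ε*n (deg v (cs ++ bs)) (≤-trans (*-monoˡ-≤ (suc d) (<⇒≤ load<θ)) θ-small)
        where
        load<θ : deg v (cs ++ bs) < θ
        load<θ = ≰⇒> (λ v-busy → stop (inj₁ (v , v-busy , ≤-reflexive (cong suc deg≡k′))))

      saturated≤excess : length (filter (λ v → deg v cs ℕ.≟ k) (allFin n)) ≤ excess k′ cs
      saturated≤excess = begin
        length (filter (λ v → deg v cs ℕ.≟ k) (allFin n)) ≡⟨ length-filter-tabulate (λ v → deg v cs ℕ.≟ k) id ⟩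
        sum (λ v → 𝟙 (deg v cs ℕ.≟ k))                    ≤⟨ sum-mono-≤ (λ v → 𝟙[≡k]≤∸k′ (deg v cs ℕ.≟ k)) ⟩
        excess k′ cs                                      ∎
        where
        open ≤-Reasoning
        𝟙[≡k]≤∸k′ : ∀ {x} (x≟k : Dec (x ≡ k)) → 𝟙 x≟k ≤ x ∸ k′
        𝟙[≡k]≤∸k′ (yes refl) = m<n⇒0<n∸m (n<1+n k′)
        𝟙[≡k]≤∸k′ (no _) = z≤n

      fewSaturated : ⟦ length (filter (λ v → deg v cs ℕ.≟ k) (allFin n)) ⟧ ≤ℚ ε *ℚ ⟦ n ⟧
      fewSaturated = ≤ε*n (length (filter (λ v → deg v cs ℕ.≟ k) (allFin n)))
        (≤-trans (*-monoˡ-≤ (suc d) (≤-trans saturated≤excess (excess≤ I))) excess-small)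

    winningInvariant : WinningInvariant k C ε strategy
    winningInvariant = record
      { Inv = Inv
      ; Continue = Continue
      ; continue? = λ h → any? (heavy? (cEdges h) (bEdges h)) ⊎-dec any? (deficient? (cEdges h))
      ; initial = initial
      ; respond = respond
      ; finish = finish
      ; maxRounds = n * k
      ; bounded = λ h (_ , _ , I) → begin
          length h             ≡⟨ length-map _ h ⟨
          length (cEdges h)    ≤⟨ m≤m+n _ _ ⟩
          2 * length (cEdges h) ≤⟨ 2*length≤ I ⟩
          n * k                ∎
      }
      where open ≤-Reasoning

-- Choosing θ

-- ε = (1 + a)/(1 + d) in lowest terms is at least 1/(1 + d).
positive⇒∃reciprocal-bound : ∀ (ε : ℚ) → Positive ε →
  Σ ℕ λ d → ∀ x n → x * suc d ≤ n → ⟦ x ⟧ ≤ℚ ε *ℚ ⟦ n ⟧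
positive⇒∃reciprocal-bound (mkℚ +[1+ a ] d _) _ = d , λ x n x[1+d]≤n →
  ℚ.toℚᵘ-cancel-≤
    (ℚᵘ.≤-respʳ-≃ (ℚᵘ.≃-sym (ℚ.toℚᵘ-homo-* (mkℚ +[1+ a ] d _) ⟦ n ⟧))
    (ℚᵘ.≤-respˡ-≃ (ℚᵘ.≃-sym (toℚᵘ⟦⟧ x))
    (ℚᵘ.≤-respʳ-≃ (ℚᵘ.*-congˡ {mkℚᵘ +[1+ a ] d} (ℚᵘ.≃-sym (toℚᵘ⟦⟧ n)))
    (*≤* (cross-multiplied x n x[1+d]≤n)))))
  where
  toℚᵘ⟦⟧ : ∀ m → toℚᵘ ⟦ m ⟧ ≃ mkℚᵘ (ℤ.+ m) 0
  toℚᵘ⟦⟧ m = ℚ.toℚᵘ-fromℚᵘ (mkℚᵘ (ℤ.+ m) 0)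
  cross-multiplied : ∀ x n → x * suc d ≤ n → ℤ.+ x ℤ.* ℤ.+ (suc d * 1) ℤ.≤ (+[1+ a ] ℤ.* ℤ.+ n) ℤ.* ℤ.+ 1
  cross-multiplied x n x[1+d]≤n = subst₂ ℤ._≤_ (ℤ.pos-* x (suc d * 1))
    (trans (ℤ.pos-* (suc a * n) 1) (cong (ℤ._* ℤ.+ 1) (ℤ.pos-* (suc a) n)))
    (ℤ.+≤+ (begin
      x * (suc d * 1) ≡⟨ cong (x *_) (*-identityʳ (suc d)) ⟩
      x * suc d       ≤⟨ x[1+d]≤n ⟩
      n               ≤⟨ m≤m*n n (suc a) ⟩
      n * suc a       ≡⟨ *-comm n (suc a) ⟩
      suc a * n       ≡⟨ *-identityʳ (suc a * n) ⟨
      suc a * n * 1   ∎))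
    where open ≤-Reasoning

x+y≤n : ∀ x y {n} → 2 * x ≤ n → 2 * y ≤ n → x + y ≤ n
x+y≤n x y {n} 2x≤n 2y≤n = *-cancelˡ-≤ 2 (begin
  2 * (x + y)     ≡⟨ *-distribˡ-+ 2 x y ⟩
  2 * x + 2 * y   ≤⟨ +-mono-≤ 2x≤n 2y≤n ⟩
  n + n           ≡⟨ cong (n +_) (+-identityʳ n) ⟨
  2 * n           ∎)
  where open ≤-Reasoning

module LargeN (k′ C d : ℕ) where

  k D m maxBusy maxHeavy excessConst roomConst n₀ : ℕ
  k = suc k′
  D = suc d
  m = 4 * k * D
  maxBusy = 4 * k * m
  maxHeavy = k * maxBusy
  excessConst = 2 + 2 * maxHeavy + k′ * C
  roomConst = 1 + 2 * suc (2 * maxHeavy) + C + excessConst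
  n₀ = m + 2 * suc roomConst + 2 * (excessConst * D)

  module _ (n′ : ℕ) (large : n₀ ≤ suc n′) where

    private
      n = suc n′

    θ : ℕ
    θ = n / m

    open Strategy n′ k′ C θ using (maxExcess)

    m≤n : m ≤ n
    m≤n = ≤-trans (≤-trans (m≤m+n m _) (m≤m+n _ _)) large

    θ*m≤n : θ * m ≤ n
    θ*m≤n = m/n*n≤m n m

    1≤θ : 1 ≤ θ
    1≤θ = m≥n⇒m/n>0 m≤n

    n≤2*θ*m : n ≤ 2 * (θ * m)
    n≤2*θ*m = begin
      n                 ≡⟨ m≡m%n+[m/n]*n n m ⟩
      n % m + θ * m     ≤⟨ +-monoˡ-≤ (θ * m) (<⇒≤ (m%n<n n m)) ⟩
      m + θ * m         ≡⟨ cong (_+ θ * m) (*-identityˡ m) ⟨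
      1 * m + θ * m     ≤⟨ +-monoˡ-≤ (θ * m) (*-monoˡ-≤ m 1≤θ) ⟩
      θ * m + θ * m     ≡⟨ cong (θ * m +_) (+-identityʳ (θ * m)) ⟨
      2 * (θ * m)       ∎
      where open ≤-Reasoning

    busyCount-bound : ∀ x → x * θ ≤ 2 * (n * k) → x ≤ maxBusy
    busyCount-bound x x*θ≤ = cancel θ 1≤θ (begin
      x * θ               ≤⟨ x*θ≤ ⟩
      2 * (n * k)         ≤⟨ *-monoʳ-≤ 2 (*-monoˡ-≤ k n≤2*θ*m) ⟩
      2 * (2 * (θ * m) * k) ≡⟨ regroup θ m k ⟩
      maxBusy * θ         ∎)
      where
      open ≤-Reasoning
      regroup : ∀ θ m k → 2 * (2 * (θ * m) * k) ≡ 4 * k * m * θ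
      regroup = solve-∀
      cancel : ∀ t → 1 ≤ t → x * t ≤ maxBusy * t → x ≤ maxBusy
      cancel (suc t) _ = *-cancelʳ-≤ x maxBusy (suc t)

    4*k*θ*D≤n : 4 * k * θ * D ≤ n
    4*k*θ*D≤n = ≤-trans (≤-reflexive (regroup θ k D)) θ*m≤n
      where
      regroup : ∀ θ k D → 4 * k * θ * D ≡ θ * (4 * k * D)
      regroup = solve-∀

    roomConst-small : 2 * suc roomConst ≤ n
    roomConst-small = ≤-trans (≤-trans (m≤n+m _ m) (m≤m+n _ _)) large

    excessConst-small : 2 * (excessConst * D) ≤ n
    excessConst-small = ≤-trans (m≤n+m _ (m + 2 * suc roomConst)) large

    room : 1 + 2 * (θ + suc (2 * maxHeavy)) + C + maxExcess maxBusy < n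
    room = ≤-trans (≤-reflexive (split θ maxHeavy C k′)) (x+y≤n (suc roomConst) (2 * k * θ) roomConst-small (begin
      2 * (2 * k * θ)   ≡⟨ regroup k θ ⟩
      4 * k * θ         ≤⟨ m≤m*n (4 * k * θ) D ⟩
      4 * k * θ * D     ≤⟨ 4*k*θ*D≤n ⟩
      n                 ∎))
      where
      open ≤-Reasoning
      split : ∀ θ A C k′ → suc (1 + 2 * (θ + suc (2 * A)) + C + (2 + 2 * A + k′ * (2 * θ + C)))
                          ≡ suc (1 + 2 * suc (2 * A) + C + (2 + 2 * A + k′ * C)) + 2 * suc k′ * θ
      split = solve-∀
      regroup : ∀ k θ → 2 * (2 * k * θ) ≡ 4 * k * θ
      regroup = solve-∀

    θ-small : θ * D ≤ n
    θ-small = ≤-trans (*-monoʳ-≤ θ (m≤n*m D (4 * k))) θ*m≤n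

    excess-small : maxExcess maxBusy * D ≤ n
    excess-small = ≤-trans (≤-reflexive (split maxHeavy k′ θ C D))
      (x+y≤n (excessConst * D) (2 * k′ * θ * D) excessConst-small (begin
        2 * (2 * k′ * θ * D)  ≡⟨ regroup k′ θ D ⟩
        4 * k′ * θ * D        ≤⟨ *-monoˡ-≤ D (*-monoˡ-≤ θ (*-monoʳ-≤ 4 (n≤1+n k′))) ⟩
        4 * k * θ * D         ≤⟨ 4*k*θ*D≤n ⟩
        n                     ∎))
      where
      open ≤-Reasoning
      split : ∀ A k′ θ C D → (2 + 2 * A + k′ * (2 * θ + C)) * D ≡ (2 + 2 * A + k′ * C) * D + 2 * k′ * θ * D
      split = solve-∀
      regroup : ∀ k′ θ D → 2 * (2 * k′ * θ * D) ≡ 4 * k′ * θ * D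
      regroup = solve-∀

lemma2p2 : (k C : ℕ) → 1 ≤ k → (ε : ℚ) → Positive ε →
    Σ ℕ λ n₀ → (n : ℕ) → n₀ ≤ n →
      Σ (ConStrategy n) λ σ → (φ : FamStrategy n) → (β : BlkStrategy n) →
        Wins k C ε σ φ β
lemma2p2 (suc k′) C _ ε ε>0 = n₀ , play
  where
  reciprocal = positive⇒∃reciprocal-bound ε ε>0
  d = proj₁ reciprocal
  open LargeN k′ C d

  play : ∀ n → n₀ ≤ n → Σ (ConStrategy n) λ σ → ∀ φ β → Wins (suc k′) C ε σ φ β
  play (suc n′) large = strategy , invariant⇒wins winning
    where
    open Strategy n′ k′ C (θ n′ large)
    winning = Analysis.winningInvariant maxBusy (busyCount-bound n′ large) (1≤θ n′ large) (room n′ large)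
      ε d (λ x → proj₂ reciprocal x (suc n′)) (θ-small n′ large) (excess-small n′ large)
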